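{- Let $g\geq 2$, $h$ and $t$ be integers with $2\leq t\leq \log h/\log g$. Then there exists a partition $\mathbb{N}=W_0\cup\cdots\cup W_{h-1}$ into pairwise disjoint sets such that each set $W_r$ ($0\le r\le h-1$) is a union of infinitely many intervals of at least $t$ consecutive integers, and the set $$A=A_g(W_0)\cup\cdots\cup A_g(W_{h-1})$$ is not a minimal asymptotic basis of order $h$.
   Context: $\mathbb{N}$ denotes the set of all nonnegative integers. For a nonempty set $W\subseteq\mathbb{N}$ and an integer $g\ge 2$, $A_g(W)$ is the set of all numbers of the form $\sum_{f\in F}a_f g^f$, where $F$ is a finite nonempty subset of $W$ and $1\le a_f\le g-1$ for each $f\in F$. For $A\subseteq\mathbb{N}$ and $h\ge 2$, let $r_h(A,n)=\#\{(a_1,\dots,a_h)\in A^h: a_1+\cdots+a_h=n\}$. $A$ is an asymptotic basis of order $h$ if $r_h(A,n)\ge 1$ for all sufficiently large integers $n$. An asymptotic basis $A$ of order $h$ is minimal if no proper subset of $A$ is an asymptotic basis of order $h$. -}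

module Defs where

open import Data.Nat using (ℕ; zero; suc; _+_; _*_; _∸_; _^_; _≤_; _<_)
open import Data.Fin using (Fin)
open import Data.Product using (Σ; ∃; _×_; _,_; proj₁)
open import Data.List using (List; []; map)
open import Data.Nat.ListAction using (sum)
open import Data.List.Relation.Unary.All using (All)
open import Data.List.Relation.Unary.Unique.Propositional using (Unique)
open import Data.Vec using (Vec)
import Data.Vec as V
open import Data.Vec.Relation.Unary.All as VA using ()
open import Relation.Binary.PropositionalEquality using (_≡_; _≢_)
open import Relation.Nullary using (¬_)
open import Function.Definitions using (Injective)

Subset : Set₁
Subset = ℕ → Set

-- n ∈ A_g(W): n = Σ_{f ∈ F} a_f g^f with F a finite nonempty subset of W
-- (represented as a nonempty list of pairs (f , a_f) with pairwise distinct f),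
-- and 1 ≤ a_f ≤ g - 1.
InAg : ℕ → Subset → Subset
InAg g W n =
  Σ (List (ℕ × ℕ)) λ F →
    (F ≢ []) ×
    Unique (map proj₁ F) ×
    All (λ p → W (proj₁ p) × 1 ≤ Data.Product.proj₂ p × Data.Product.proj₂ p ≤ g ∸ 1) F ×
    (n ≡ sum (map (λ p → Data.Product.proj₂ p * g ^ proj₁ p) F))

Represents : Subset → ℕ → ℕ → Set
Represents A h n = Σ (Vec ℕ h) λ v → VA.All A v × V.sum v ≡ n

AsymptoticBasis : Subset → ℕ → Set
AsymptoticBasis A h = ∃ λ N → ∀ n → N ≤ n → Represents A h n

ProperSubset : Subset → Subset → Set
ProperSubset B A = (∀ x → B x → A x) × (∃ λ x → A x × ¬ B x)

MinimalAsymptoticBasis : Subset → ℕ → Set₁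
MinimalAsymptoticBasis A h =
  AsymptoticBasis A h × (∀ (B : Subset) → ProperSubset B A → ¬ AsymptoticBasis B h)

UnionOfInfManyIntervals : ℕ → Subset → Set
UnionOfInfManyIntervals t W =
  Σ (ℕ → ℕ) λ a → Σ (ℕ → ℕ) λ b →
    (∀ k → a k + t ≤ suc (b k)) ×
    Injective _≡_ _≡_ (λ k → (a k , b k)) ×
    (∀ n → W n → ∃ λ k → a k ≤ n × n ≤ b k) ×
    (∀ n k → a k ≤ n → n ≤ b k → W n)

-- The class W_r of a partition given by a colouring c : ℕ → Fin h.
Part : ∀ {h} → (ℕ → Fin h) → Fin h → Subset
Part c r n = c n ≡ r

UnionA : ∀ {h} → ℕ → (ℕ → Fin h) → Subset
UnionA g c n = ∃ λ r → InAg g (Part c r) n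

-- Let B be A with the element g removed; we show that B is still an asymptotic basis of order h.
-- The classes have period 3t: residues below 2t get colour 0, and the last t residues of the k-th
-- period get colour 1 + (k mod (h - 1)). So positions 0, 1, t, t + 1 have colour 0, and shifting a
-- position of nonzero colour down by t lands on colour 0.
-- Write n in base g and split its digits by colour. A nonzero colour class gives a summand in B,
-- its two lowest digits being 0. If the colour-0 part is not g, this writes n with at most h
-- summands. If it is g, all other digits sit at positions >= t, so n = g + g^t y, where y (those
-- digits shifted down by t) and y + g lie in A_g(W_0) minus g, and n = (g^t - 1) y + (y + g) uses
-- g^t <= h summands. Finally, while there are fewer than h summands and n >= h g^3, some summand
-- is at least g^3, and detaching or splitting one of its digits at a position >= 3 turns it into
-- two elements of B.

module Submission where

open import Defs
open import Data.Bool using (Bool; true; false; if_then_else_; not; T)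
open import Data.Empty using (⊥-elim)
open import Data.Fin using (Fin; zero; suc; toℕ)
import Data.Fin as Fin
import Data.Fin.Properties as FinP
open import Data.List using (List; []; _∷_; _++_; map; length; tabulate; replicate)
open import Data.List.Membership.Propositional using (_∈_)
open import Data.List.Membership.Propositional.Properties using (∈-tabulate⁺)
open import Data.List.Properties using (map-∘; map-++; length-++; length-tabulate; length-replicate)
open import Data.List.Relation.Unary.All using (All; []; _∷_)
import Data.List.Relation.Unary.All as All
import Data.List.Relation.Unary.All.Properties as All
open import Data.List.Relation.Unary.AllPairs using ([]; _∷_)
open import Data.List.Relation.Unary.Any using (Any; here; there)
open import Data.List.Relation.Unary.Unique.Propositional using (Unique)
import Data.List.Relation.Unary.Unique.Propositional.Properties as Unique
open import Data.Nat
open import Data.Nat.DivMod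
open import Data.Nat.ListAction using (sum)
open import Data.Nat.ListAction.Properties using (sum-++)
open import Data.Nat.Properties
open import Data.Nat.Tactic.RingSolver using (solve-∀)
open import Data.Product using (Σ; ∃; _×_; _,_; proj₁; map₁)
open import Data.Unit using (tt)
open import Data.Vec using ([]; _∷_)
open import Data.Vec.Relation.Unary.All using ([]; _∷_)
open import Function using (_∘_)
open import Function.Definitions using (Injective)
open import Relation.Binary.PropositionalEquality
open import Relation.Nullary using (¬_; yes; no)
open import Relation.Nullary.Decidable using (⌊_⌋; toWitness; toWitnessFalse; decidable-stable)

<⇒≤∸1 : ∀ {m n} → m < n → m ≤ n ∸ 1
<⇒≤∸1 (s≤s m≤n) = m≤n

n<g^n : ∀ {g} → 1 < g → ∀ n → n < g ^ n
n<g^n 1<g zero    = z<s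
n<g^n {g} 1<g (suc n) = begin-strict
  suc n        ≤⟨ n<g^n 1<g n ⟩
  g ^ n        <⟨ m<m*n (g ^ n) g {{m^n≢0 g n {{>-nonZero (<-trans z<s 1<g)}}}} 1<g ⟩
  g ^ n * g    ≡⟨ *-comm (g ^ n) g ⟩
  g * g ^ n    ∎
  where open ≤-Reasoning

1<g^t : ∀ {g t} → 1 < g → 1 ≤ t → 1 < g ^ t
1<g^t {g} 1<g 1≤t = <-≤-trans (n<g^n 1<g 1) (^-monoʳ-≤ g {{>-nonZero (<-trans z<s 1<g)}} 1≤t)

module Expansions (g : ℕ) where

  eval : (ℕ → ℕ) → ℕ → ℕ
  eval d zero    = 0
  eval d (suc M) = d 0 + g * eval (d ∘ suc) M

  eval-cong : ∀ M {d e} → d ≗ e → eval d M ≡ eval e M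
  eval-cong zero    d≗e = refl
  eval-cong (suc M) d≗e = cong₂ (λ x y → x + g * y) (d≗e 0) (eval-cong M (d≗e ∘ suc))

  eval-+ : ∀ M d e → eval (λ i → d i + e i) M ≡ eval d M + eval e M
  eval-+ zero    d e = refl
  eval-+ (suc M) d e =
    trans (cong (λ x → d 0 + e 0 + g * x) (eval-+ M (d ∘ suc) (e ∘ suc)))
          (interchange (d 0) (e 0) (eval (d ∘ suc) M) (eval (e ∘ suc) M) g)
    where
    interchange : ∀ a b x y G → a + b + G * (x + y) ≡ (a + G * x) + (b + G * y)
    interchange = solve-∀

  eval-vanishing : ∀ M d → (∀ i → i < M → d i ≡ 0) → eval d M ≡ 0
  eval-vanishing zero    d d≡0 = refl
  eval-vanishing (suc M) d d≡0 = begin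
    d 0 + g * eval (d ∘ suc) M
      ≡⟨ cong₂ (λ x y → x + g * y) (d≡0 0 z<s) (eval-vanishing M (d ∘ suc) (λ i i<M → d≡0 (suc i) (s<s i<M))) ⟩
    g * 0
      ≡⟨ *-zeroʳ g ⟩
    0 ∎
    where open ≡-Reasoning

  eval-shift : ∀ k M d → eval d (k + M) ≡ eval d k + g ^ k * eval (λ i → d (k + i)) M
  eval-shift zero    M d = sym (*-identityˡ (eval d M))
  eval-shift (suc k) M d =
    trans (cong (λ x → d 0 + g * x) (eval-shift k M (d ∘ suc)))
          (distrib (d 0) (eval (d ∘ suc) k) (g ^ k) (eval (λ i → d (suc (k + i))) M) g)
    where
    distrib : ∀ a x p y G → a + G * (x + p * y) ≡ a + G * x + G * p * y
    distrib = solve-∀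

  restrict : (ℕ → Bool) → (ℕ → ℕ) → ℕ → ℕ
  restrict p d i = if p i then d i else 0

  single : ℕ → ℕ → ℕ → ℕ
  single f a = restrict (_≡ᵇ f) (λ _ → a)

  eval-restrict : ∀ M p d → eval d M ≡ eval (restrict p d) M + eval (restrict (not ∘ p) d) M
  eval-restrict M p d = trans (eval-cong M split) (eval-+ M (restrict p d) (restrict (not ∘ p) d))
    where
    split : ∀ i → d i ≡ restrict p d i + restrict (not ∘ p) d i
    split i with p i
    ... | true  = sym (+-identityʳ (d i))
    ... | false = refl

  eval-at : ∀ f M d → f < M → eval (restrict (_≡ᵇ f) d) M ≡ d f * g ^ f
  eval-at zero (suc M) d _ = begin
    d 0 + g * eval (λ _ → 0) M ≡⟨ cong (λ x → d 0 + g * x) (eval-vanishing M _ (λ _ _ → refl)) ⟩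
    d 0 + g * 0               ≡⟨ cong (d 0 +_) (*-zeroʳ g) ⟩
    d 0 + 0                   ≡⟨ +-identityʳ (d 0) ⟩
    d 0                       ≡⟨ *-identityʳ (d 0) ⟨
    d 0 * 1                   ∎
    where open ≡-Reasoning
  eval-at (suc f) (suc M) d (s<s f<M) =
    trans (cong (g *_) (eval-at f M (d ∘ suc) f<M)) (swap (d (suc f)) (g ^ f) g)
    where
    swap : ∀ a p G → G * (a * p) ≡ a * (G * p)
    swap = solve-∀

  eval-single : ∀ f a {M} → f < M → eval (single f a) M ≡ a * g ^ f
  eval-single f a {M} = eval-at f M (λ _ → a)

  restrict-support : ∀ p d {i} → restrict p d i ≢ 0 → T (p i)
  restrict-support p d {i} ≢0 with p i
  ... | true  = tt
  ... | false = ⊥-elim (≢0 refl)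

  restrict-≢0 : ∀ p d {i} → restrict p d i ≢ 0 → d i ≢ 0
  restrict-≢0 p d {i} ≢0 with p i
  ... | true  = ≢0
  ... | false = ⊥-elim (≢0 refl)

  restrict-vanishing : ∀ p d {i} → d i ≡ 0 → restrict p d i ≡ 0
  restrict-vanishing p d {i} d≡0 with p i
  ... | true  = d≡0
  ... | false = refl

  single-off : ∀ {f a i} → i ≢ f → single f a i ≡ 0
  single-off {f} {a} {i} i≢f with i ≡ᵇ f in i≡ᵇf
  ... | true  = ⊥-elim (i≢f (≡ᵇ⇒≡ i f (subst T (sym i≡ᵇf) tt)))
  ... | false = refl

  single-support : ∀ {f a i} → single f a i ≢ 0 → i ≡ f
  single-support {f} {a} {i} ≢0 = ≡ᵇ⇒≡ i f (restrict-support (_≡ᵇ f) (λ _ → a) {i} ≢0)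

  Digits : (ℕ → ℕ) → Set
  Digits d = ∀ i → d i < g

  restrict-digits : ∀ p {d} → Digits d → Digits (restrict p d)
  restrict-digits p {d} d<g i with p i
  ... | true  = d<g i
  ... | false = ≤-<-trans z≤n (d<g i)

  +-digits : ∀ {d e} → Digits d → Digits e → (∀ i → e i ≢ 0 → d i ≡ 0) → Digits (λ i → d i + e i)
  +-digits {d} {e} d<g e<g disjoint i with e i ≟ 0
  ... | yes e≡0 = subst (_< g) (sym (trans (cong (d i +_) e≡0) (+-identityʳ (d i)))) (d<g i)
  ... | no  e≢0 = subst (_< g) (sym (cong (_+ e i) (disjoint i e≢0))) (e<g i)

  digit-step : ∀ {a v X} → a < g → v < X → a + g * v < g * X
  digit-step {a} {v} {X} a<g v<X = begin-strict
    a + g * v  <⟨ +-monoˡ-< (g * v) a<g ⟩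
    g + g * v  ≡⟨ *-suc g v ⟨
    g * suc v  ≤⟨ *-monoʳ-≤ g v<X ⟩
    g * X      ∎
    where open ≤-Reasoning

  high-digit : ∀ M m d → Digits d → g ^ m ≤ eval d M → ∃ λ f → m ≤ f × f < M × d f ≢ 0
  high-digit zero m d d<g big = ⊥-elim (<⇒≱ (m^n>0 g {{>-nonZero (≤-<-trans z≤n (d<g 0))}} m) big)
  high-digit (suc M) zero d d<g big with d 0 ≟ 0
  ... | no  d0≢0 = 0 , z≤n , z<s , d0≢0
  ... | yes d0≡0 with high-digit M zero (d ∘ suc) (d<g ∘ suc) tail≥1
    where
    tail≥1 : 1 ≤ eval (d ∘ suc) M
    tail≥1 = n≢0⇒n>0 λ tail≡0 → <⇒≢ big (sym (begin
      d 0 + g * eval (d ∘ suc) M ≡⟨ cong₂ (λ x y → x + g * y) d0≡0 tail≡0 ⟩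
      g * 0                      ≡⟨ *-zeroʳ g ⟩
      0                          ∎))
      where open ≡-Reasoning
  ... | f , _ , f<M , df≢0 = suc f , z≤n , s<s f<M , df≢0
  high-digit (suc M) (suc m) d d<g big with high-digit M m (d ∘ suc) (d<g ∘ suc) (≮⇒≥ not-small)
    where
    not-small : ¬ eval (d ∘ suc) M < g ^ m
    not-small small = <⇒≱ (digit-step (d<g 0) small) big
  ... | f , m≤f , f<M , df≢0 = suc f , s≤s m≤f , s<s f<M , df≢0

  module _ .{{_ : NonZero g}} where

    digit : ℕ → ℕ → ℕ
    digit n zero    = n % g
    digit n (suc i) = digit (n / g) i

    digit<g : ∀ n → Digits (digit n)
    digit<g n zero    = m%n<n n g
    digit<g n (suc i) = digit<g (n / g) i

    eval-digit : ∀ M n → n < g ^ M → eval (digit n) M ≡ n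
    eval-digit zero    n (s≤s z≤n) = refl
    eval-digit (suc M) n n<g^M = begin
      n % g + g * eval (digit (n / g)) M ≡⟨ cong (λ x → n % g + g * x) (eval-digit M (n / g) n/g<g^M) ⟩
      n % g + g * (n / g)                ≡⟨ cong (n % g +_) (*-comm g (n / g)) ⟩
      n % g + n / g * g                  ≡⟨ m≡m%n+[m/n]*n n g ⟨
      n                                  ∎
      where
      open ≡-Reasoning
      n/g<g^M : n / g < g ^ M
      n/g<g^M = m<n*o⇒m/o<n (subst (n <_) (*-comm g (g ^ M)) n<g^M)

  term : ℕ × ℕ → ℕ
  term (f , a) = a * g ^ f

  cons-nonzero : ℕ → List (ℕ × ℕ) → List (ℕ × ℕ)
  cons-nonzero zero      F = F
  cons-nonzero a@(suc _) F = (0 , a) ∷ F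

  expansion : (ℕ → ℕ) → ℕ → List (ℕ × ℕ)
  expansion d zero    = []
  expansion d (suc M) = cons-nonzero (d 0) (map (map₁ suc) (expansion (d ∘ suc) M))

  sum-shift : ∀ F → sum (map term (map (map₁ suc) F)) ≡ g * sum (map term F)
  sum-shift []            = sym (*-zeroʳ g)
  sum-shift ((f , a) ∷ F) = begin
    a * (g * g ^ f) + sum (map term (map (map₁ suc) F)) ≡⟨ cong₂ _+_ (swap a (g ^ f) g) (sum-shift F) ⟩
    g * (a * g ^ f) + g * sum (map term F)              ≡⟨ *-distribˡ-+ g (a * g ^ f) _ ⟨
    g * (a * g ^ f + sum (map term F))                  ∎
    where
    open ≡-Reasoning
    swap : ∀ a p G → a * (G * p) ≡ G * (a * p)
    swap = solve-∀

  sum-cons-nonzero : ∀ a F → sum (map term (cons-nonzero a F)) ≡ a + sum (map term F)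
  sum-cons-nonzero zero      F = refl
  sum-cons-nonzero a@(suc _) F = cong (_+ sum (map term F)) (*-identityʳ a)

  sum-expansion : ∀ M d → sum (map term (expansion d M)) ≡ eval d M
  sum-expansion zero    d = refl
  sum-expansion (suc M) d = begin
    sum (map term (cons-nonzero (d 0) shifted))  ≡⟨ sum-cons-nonzero (d 0) shifted ⟩
    d 0 + sum (map term shifted)                 ≡⟨ cong (d 0 +_) (sum-shift (expansion (d ∘ suc) M)) ⟩
    d 0 + g * sum (map term (expansion (d ∘ suc) M)) ≡⟨ cong (λ x → d 0 + g * x) (sum-expansion M (d ∘ suc)) ⟩
    d 0 + g * eval (d ∘ suc) M                   ∎
    where
    open ≡-Reasoning
    shifted : List (ℕ × ℕ)
    shifted = map (map₁ suc) (expansion (d ∘ suc) M)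

  cons-nonzero-All : ∀ {P : ℕ × ℕ → Set} a F → (a ≢ 0 → P (0 , a)) → All P F → All P (cons-nonzero a F)
  cons-nonzero-All zero      F _  all = all
  cons-nonzero-All (suc a) F P₀ all = P₀ (λ ()) ∷ all

  cons-nonzero-Unique : ∀ a F → All (0 ≢_) (map proj₁ F) → Unique (map proj₁ F) → Unique (map proj₁ (cons-nonzero a F))
  cons-nonzero-Unique zero    F _     unique = unique
  cons-nonzero-Unique (suc a) F fresh unique = fresh ∷ unique

  expansion-digits : ∀ M d → All (λ (f , a) → d f ≡ a × a ≢ 0) (expansion d M)
  expansion-digits zero    d = []
  expansion-digits (suc M) d = cons-nonzero-All (d 0) _ (refl ,_) (All.map⁺ (expansion-digits M (d ∘ suc)))

  expansion-positions : ∀ M d → Unique (map proj₁ (expansion d M))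
  expansion-positions zero    d = []
  expansion-positions (suc M) d = cons-nonzero-Unique (d 0) (map (map₁ suc) F)
      (subst (All (0 ≢_)) positions-shift (All.map⁺ (All.universal (λ _ ()) (map proj₁ F))))
      (subst Unique positions-shift (Unique.map⁺ suc-injective (expansion-positions M (d ∘ suc))))
    where
    F : List (ℕ × ℕ)
    F = expansion (d ∘ suc) M
    positions-shift : map suc (map proj₁ F) ≡ map proj₁ (map (map₁ suc) F)
    positions-shift = trans (sym (map-∘ F)) (map-∘ F)

  InAg-eval : ∀ {W d} M → Digits d → (∀ i → d i ≢ 0 → W i) → eval d M ≢ 0 → InAg g W (eval d M)
  InAg-eval {W} {d} M d<g support eval≢0 =
    expansion d M , nonempty , expansion-positions M d ,
    All.map (λ { {f , a} (df≡a , a≢0) → support f (subst (_≢ 0) (sym df≡a) a≢0) , n≢0⇒n>0 a≢0 ,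
                   <⇒≤∸1 (subst (_< g) df≡a (d<g f)) })
            (expansion-digits M d) ,
    sym (sum-expansion M d)
    where
    nonempty : expansion d M ≢ []
    nonempty empty = eval≢0 (trans (sym (sum-expansion M d)) (cong (sum ∘ map term) empty))

module Pieces (g : ℕ) (1<g : 1 < g) {h : ℕ} (c : ℕ → Fin h) where

  open Expansions g

  instance
    g-nonZero : NonZero g
    g-nonZero = >-nonZero (<-trans z<s 1<g)

  B : Subset
  B x = UnionA g c x × x ≢ g

  Monochrome : (ℕ → ℕ) → Fin h → Set
  Monochrome d r = ∀ i → d i ≢ 0 → c i ≡ r

  record Piece : Set where
    constructor piece
    field
      digits     : ℕ → ℕ
      width      : ℕ
      colour     : Fin h
      digits<g   : Digits digits
      monochrome : Monochrome digits colour
      value≢0    : eval digits width ≢ 0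
      value≢g    : eval digits width ≢ g

  open Piece

  value : Piece → ℕ
  value p = eval (digits p) (width p)

  total : List Piece → ℕ
  total ps = sum (map value ps)

  total-++ : ∀ ps qs → total (ps ++ qs) ≡ total ps + total qs
  total-++ ps qs = trans (cong sum (map-++ value ps qs)) (sum-++ (map value ps) (map value qs))

  piece∈B : ∀ p → B (value p)
  piece∈B p = (colour p , InAg-eval (width p) (digits<g p) (monochrome p) (value≢0 p)) , value≢g p

  restrict-monochrome : ∀ q {d r} → Monochrome d r → Monochrome (restrict q d) r
  restrict-monochrome q {d} mono i ≢0 = mono i (restrict-≢0 q d ≢0)

  single-monochrome : ∀ {f a r} → c f ≡ r → Monochrome (single f a) r
  single-monochrome cf≡r i ≢0 = trans (cong c (single-support ≢0)) cf≡r

  +-monochrome : ∀ {d e r} → Monochrome d r → Monochrome e r → Monochrome (λ i → d i + e i) r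
  +-monochrome {d} {e} mono-d mono-e i ≢0 with d i ≟ 0
  ... | no  d≢0 = mono-d i d≢0
  ... | yes d≡0 = mono-e i (λ e≡0 → ≢0 (cong₂ _+_ d≡0 e≡0))

  g*x≢1 : ∀ x → g * x ≢ 1
  g*x≢1 x eq = <⇒≢ 1<g (sym (m*n≡1⇒m≡1 g x eq))

  g*[g*x]≢g : ∀ x → g * (g * x) ≢ g
  g*[g*x]≢g x eq = g*x≢1 x (*-cancelˡ-≡ (g * x) 1 g (trans eq (sym (*-identityʳ g))))

  eval≢g : ∀ M d → d 0 ≡ 0 → d 1 ≡ 0 → eval d M ≢ g
  eval≢g zero          d _   _   = <⇒≢ (<-trans z<s 1<g)
  eval≢g (suc zero)    d d0≡0 _ eq = <⇒≢ (<-trans z<s 1<g) (trans (sym (trans (cong (_+ g * 0) d0≡0) (*-zeroʳ g))) eq)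
  eval≢g (suc (suc M)) d d0≡0 d1≡0 rewrite d0≡0 | d1≡0 = g*[g*x]≢g (eval (λ i → d (suc (suc i))) M)

  *-power≢0 : ∀ {a} f → 0 < a → a * g ^ f ≢ 0
  *-power≢0 {a} f 0<a = ≢-nonZero⁻¹ (a * g ^ f) {{m*n≢0 a (g ^ f) {{>-nonZero 0<a}} {{m^n≢0 g f}}}}

  *-power≢g : ∀ a f → 2 ≤ f → a * g ^ f ≢ g
  *-power≢g a (suc (suc f)) (s≤s (s≤s z≤n)) eq = g*[g*x]≢g (a * g ^ f) (trans (rearrange a (g ^ f) g) eq)
    where
    rearrange : ∀ a p G → G * (G * (a * p)) ≡ a * (G * (G * p))
    rearrange = solve-∀

  power≢1 : ∀ f → 1 ≤ f → g ^ f ≢ 1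
  power≢1 (suc f) _ = g*x≢1 (g ^ f)

  single-piece : ∀ f a M → f < M → 0 < a → a < g → a * g ^ f ≢ g → Piece
  single-piece f a M f<M 0<a a<g ≢g = record
    { digits     = single f a
    ; width      = M
    ; colour     = c f
    ; digits<g   = restrict-digits (_≡ᵇ f) (λ _ → a<g)
    ; monochrome = single-monochrome refl
    ; value≢0    = *-power≢0 f 0<a ∘ trans (sym (eval-single f a f<M))
    ; value≢g    = ≢g ∘ trans (sym (eval-single f a f<M))
    }

  g∸1<g : g ∸ 1 < g
  g∸1<g = ∸-monoʳ-< z<s (<⇒≤ 1<g)

  TwoPieces : ℕ → Set
  TwoPieces x = Σ (Piece × Piece) λ (p , q) → value p + value q ≡ x

  split-single : ∀ f a M → 3 ≤ f → f < M → 0 < a → a < g → TwoPieces (a * g ^ f)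
  split-single (suc f) 1 M (s≤s 2≤f) f+1<M _ _ =
      ( single-piece f (g ∸ 1) M f<M (m<n⇒0<n∸m 1<g) g∸1<g (*-power≢g (g ∸ 1) f 2≤f)
      , single-piece f 1 M f<M z<s 1<g (*-power≢g 1 f 2≤f) )
    , (begin
      eval (single f (g ∸ 1)) M + eval (single f 1) M ≡⟨ cong₂ _+_ (eval-single f (g ∸ 1) f<M) (eval-single f 1 f<M) ⟩
      (g ∸ 1) * g ^ f + 1 * g ^ f                     ≡⟨ *-distribʳ-+ (g ^ f) (g ∸ 1) 1 ⟨
      (g ∸ 1 + 1) * g ^ f                             ≡⟨ cong (_* g ^ f) (m∸n+n≡m (<⇒≤ 1<g)) ⟩
      g * g ^ f                                       ≡⟨ *-identityˡ (g * g ^ f) ⟨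
      1 * (g * g ^ f)                                 ∎)
    where
    open ≡-Reasoning
    f<M : f < M
    f<M = <-trans (n<1+n f) f+1<M
  split-single f (suc (suc a)) M 3≤f f<M _ a+2<g =
      ( single-piece f 1 M f<M z<s 1<g (*-power≢g 1 f 2≤f)
      , single-piece f (suc a) M f<M z<s (<-trans (n<1+n (suc a)) a+2<g) (*-power≢g (suc a) f 2≤f) )
    , trans (cong₂ _+_ (eval-single f 1 f<M) (eval-single f (suc a) f<M)) (sym (*-distribʳ-+ (g ^ f) 1 (suc a)))
    where
    2≤f : 2 ≤ f
    2≤f = ≤-trans (n≤1+n 2) 3≤f

  module SplitAt (c0≡c1 : c 0 ≡ c 1) (p : Piece) {f : ℕ} (3≤f : 3 ≤ f) (f<M : f < width p) (df≢0 : digits p f ≢ 0) where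

    private
      M : ℕ
      M = width p
      d : ℕ → ℕ
      d = digits p
      a : ℕ
      a = d f
      0<a : 0 < a
      0<a = n≢0⇒n>0 df≢0
      2≤f : 2 ≤ f
      2≤f = ≤-trans (n≤1+n 2) 3≤f

    rest : ℕ → ℕ
    rest = restrict (not ∘ (_≡ᵇ f)) d

    value≡ : value p ≡ a * g ^ f + eval rest M
    value≡ = trans (eval-restrict M (_≡ᵇ f) d) (cong (_+ eval rest M) (eval-at f M d f<M))

    lead-piece : Piece
    lead-piece = single-piece f a M f<M 0<a (digits<g p f) (*-power≢g a f 2≤f)

    rest-piece : eval rest M ≢ 0 → eval rest M ≢ g → Piece
    rest-piece = piece rest M (colour p) (restrict-digits _ (digits<g p)) (restrict-monochrome _ (monochrome p))

    rest≡g⇒colour : eval rest M ≡ g → c 0 ≡ colour p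
    rest≡g⇒colour rest≡g with rest 0 ≟ 0 | rest 1 ≟ 0
    ... | no  r0≢0 | _        = restrict-monochrome (not ∘ (_≡ᵇ f)) (monochrome p) 0 r0≢0
    ... | yes _    | no r1≢0  = trans c0≡c1 (restrict-monochrome (not ∘ (_≡ᵇ f)) (monochrome p) 1 r1≢0)
    ... | yes r0≡0 | yes r1≡0 = ⊥-elim (eval≢g M rest r0≡0 r1≡0 rest≡g)

    -- If the rest is g, split a g^f + g as (a g^f + (g - 1)) + 1.
    carried-digits : ℕ → ℕ
    carried-digits i = single f a i + single 0 (g ∸ 1) i

    carried-digits<g : Digits carried-digits
    carried-digits<g =
      +-digits (restrict-digits (_≡ᵇ f) (λ _ → digits<g p f)) (restrict-digits (_≡ᵇ 0) (λ _ → g∸1<g)) disjoint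
      where
      disjoint : ∀ i → single 0 (g ∸ 1) i ≢ 0 → single f a i ≡ 0
      disjoint i ≢0 = single-off {f} {a} {i} λ i≡f →
        <⇒≢ (≤-trans z<s 3≤f) (trans (sym (single-support {0} {g ∸ 1} {i} ≢0)) i≡f)

    carried-value : eval carried-digits M ≡ a * g ^ f + (g ∸ 1) * 1
    carried-value = trans (eval-+ M (single f a) (single 0 (g ∸ 1)))
                          (cong₂ _+_ (eval-single f a f<M) (eval-single 0 (g ∸ 1) (≤-<-trans z≤n f<M)))

    carried-value≢g : eval carried-digits M ≢ g
    carried-value≢g eq = power≢1 f (≤-trans z<s 3≤f) (m*n≡1⇒n≡1 a (g ^ f) a*g^f≡1)
      where
      a*g^f≡1 : a * g ^ f ≡ 1
      a*g^f≡1 = +-cancelʳ-≡ ((g ∸ 1) * 1) _ 1 (begin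
        a * g ^ f + (g ∸ 1) * 1  ≡⟨ carried-value ⟨
        eval carried-digits M    ≡⟨ eq ⟩
        g                        ≡⟨ m+[n∸m]≡n (<⇒≤ 1<g) ⟨
        1 + (g ∸ 1)              ≡⟨ cong (1 +_) (*-identityʳ (g ∸ 1)) ⟨
        1 + (g ∸ 1) * 1          ∎)
        where open ≡-Reasoning

    carried-piece : c 0 ≡ colour p → Piece
    carried-piece c0≡r =
      piece carried-digits M (colour p) carried-digits<g
        (+-monochrome (single-monochrome (monochrome p f df≢0)) (single-monochrome c0≡r))
        (*-power≢0 f 0<a ∘ m+n≡0⇒m≡0 _ ∘ trans (sym carried-value))
        carried-value≢g

    unit-piece : Piece
    unit-piece = single-piece 0 1 M (≤-<-trans z≤n f<M) z<s 1<g (<⇒≢ 1<g)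

    split : TwoPieces (value p)
    split with eval rest M ≟ 0 | eval rest M ≟ g
    ... | yes rest≡0 | _ =
      subst TwoPieces (sym (trans value≡ (trans (cong (a * g ^ f +_) rest≡0) (+-identityʳ _))))
            (split-single f a M 3≤f f<M 0<a (digits<g p f))
    ... | no rest≢0 | no rest≢g =
      (lead-piece , rest-piece rest≢0 rest≢g) , trans (cong (_+ eval rest M) (eval-single f a f<M)) (sym value≡)
    ... | no _ | yes rest≡g = (carried-piece (rest≡g⇒colour rest≡g) , unit-piece) , (begin
      eval carried-digits M + eval (single 0 1) M ≡⟨ cong₂ _+_ carried-value (eval-single 0 1 (≤-<-trans z≤n f<M)) ⟩
      a * g ^ f + (g ∸ 1) * 1 + 1 * 1     ≡⟨ +-assoc (a * g ^ f) _ _ ⟩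
      a * g ^ f + ((g ∸ 1) * 1 + 1)       ≡⟨ cong (λ x → a * g ^ f + (x + 1)) (*-identityʳ (g ∸ 1)) ⟩
      a * g ^ f + (g ∸ 1 + 1)             ≡⟨ cong (a * g ^ f +_) (trans (m∸n+n≡m (<⇒≤ 1<g)) (sym rest≡g)) ⟩
      a * g ^ f + eval rest M             ≡⟨ value≡ ⟨
      value p                             ∎)
      where open ≡-Reasoning

  split-piece : c 0 ≡ c 1 → ∀ p → g ^ 3 ≤ value p → TwoPieces (value p)
  split-piece c0≡c1 p big with high-digit (width p) 3 (digits p) (digits<g p) big
  ... | f , 3≤f , f<M , df≢0 = SplitAt.split c0≡c1 p 3≤f f<M df≢0

  represent : ∀ ps → Represents B (length ps) (total ps)
  represent []       = [] , [] , refl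
  represent (p ∷ ps) with represent ps
  ... | v , v⊆B , Σv≡ = value p ∷ v , piece∈B p ∷ v⊆B , cong (value p +_) Σv≡

  large-piece : ∀ ps → length ps * g ^ 3 < total ps → Any (λ p → g ^ 3 ≤ value p) ps
  large-piece (p ∷ ps) more with g ^ 3 ≤? value p
  ... | yes large = here large
  ... | no  small = there (large-piece ps (≰⇒> λ total≤ → <⇒≱ more (+-mono-≤ (<⇒≤ (≰⇒> small)) total≤)))

  split-any : c 0 ≡ c 1 → ∀ ps → Any (λ p → g ^ 3 ≤ value p) ps →
    Σ (List Piece) λ qs → length qs ≡ suc (length ps) × total qs ≡ total ps
  split-any c0≡c1 (p ∷ ps) (here large) with split-piece c0≡c1 p large
  ... | (q , q′) , q+q′≡p = q ∷ q′ ∷ ps , refl , trans (sym (+-assoc (value q) (value q′) _)) (cong (_+ total ps) q+q′≡p)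
  split-any c0≡c1 (p ∷ ps) (there any) with split-any c0≡c1 ps any
  ... | qs , len≡ , total≡ = p ∷ qs , cong suc len≡ , cong (value p +_) total≡

  pad : c 0 ≡ c 1 → ∀ {H} ps → length ps ≤ H → H * g ^ 3 ≤ total ps → Represents B H (total ps)
  pad c0≡c1 {H} ps len≤H = pad-by (H ∸ length ps) ps (m+[n∸m]≡n len≤H)
    where
    pad-by : ∀ k ps → length ps + k ≡ H → H * g ^ 3 ≤ total ps → Represents B H (total ps)
    pad-by zero    ps len≡ _ = subst (λ H → Represents B H (total ps)) (trans (sym (+-identityʳ _)) len≡) (represent ps)
    pad-by (suc k) ps len≡ big with split-any c0≡c1 ps (large-piece ps (<-≤-trans (*-monoˡ-< (g ^ 3) {{m^n≢0 g 3}} len<H) big))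
      where
      len<H : length ps < H
      len<H = subst (length ps <_) len≡ (m<m+n (length ps) z<s)
    ... | qs , len≡′ , total≡ =
      subst (Represents B H) total≡
        (pad-by k qs (trans (cong (_+ k) len≡′) (trans (sym (+-suc (length ps) k)) len≡)) (subst (H * g ^ 3 ≤_) (sym total≡) big))

  at-most-one-piece : ∀ M r d → Digits d → Monochrome d r → eval d M ≢ g →
    Σ (List Piece) λ ps → length ps ≤ 1 × total ps ≡ eval d M
  at-most-one-piece M r d d<g mono ≢g with eval d M ≟ 0
  ... | yes ≡0 = [] , z≤n , sym ≡0
  ... | no  ≢0 = piece d M r d<g mono ≢0 ≢g ∷ [] , ≤-refl , +-identityʳ (eval d M)

  colour-pieces : ∀ M (rs : List (Fin h)) d → Digits d → d 0 ≡ 0 → d 1 ≡ 0 → (∀ i → d i ≢ 0 → c i ∈ rs) →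
    Σ (List Piece) λ ps → length ps ≤ length rs × total ps ≡ eval d M
  colour-pieces M [] d _ _ _ support =
    [] , z≤n , sym (eval-vanishing M d λ i _ → decidable-stable (d i ≟ 0) λ d≢0 → case-[] (support i d≢0))
    where
    case-[] : ∀ {x : Fin h} → ¬ x ∈ []
    case-[] ()
  colour-pieces M (r ∷ rs) d d<g d0≡0 d1≡0 support
    with at-most-one-piece M r (restrict on-r d) (restrict-digits on-r d<g)
           (λ i ≢0 → toWitness (restrict-support on-r d ≢0))
           (eval≢g M _ (restrict-vanishing on-r d d0≡0) (restrict-vanishing on-r d d1≡0))
       | colour-pieces M rs (restrict (not ∘ on-r) d) (restrict-digits (not ∘ on-r) d<g)
           (restrict-vanishing (not ∘ on-r) d d0≡0) (restrict-vanishing (not ∘ on-r) d d1≡0) support′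
    where
    on-r : ℕ → Bool
    on-r i = ⌊ c i Fin.≟ r ⌋
    support′ : ∀ i → restrict (not ∘ on-r) d i ≢ 0 → c i ∈ rs
    support′ i ≢0 with support i (restrict-≢0 (not ∘ on-r) d ≢0)
    ... | here  ci≡r = ⊥-elim (toWitnessFalse (restrict-support (not ∘ on-r) d ≢0) ci≡r)
    ... | there ci∈rs = ci∈rs
  ... | ps , len-ps , total-ps | qs , len-qs , total-qs =
    ps ++ qs ,
    subst (_≤ suc (length rs)) (sym (length-++ ps)) (+-mono-≤ len-ps len-qs) ,
    trans (total-++ ps qs) (trans (cong₂ _+_ total-ps total-qs) (sym (eval-restrict M _ d)))

module Decomposition (g : ℕ) (1<g : 1 < g) (h′ t : ℕ) (c : ℕ → Fin (suc h′))
    (c-low : ∀ i → i < 2 + t → c i ≡ zero) (c-shift : ∀ i → c (t + i) ≢ zero → c i ≡ zero)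
    (g^t≤h : g ^ t ≤ suc h′) where

  open Expansions g
  open Pieces g 1<g c

  c0≡c1 : c 0 ≡ c 1
  c0≡c1 = trans (c-low 0 z<s) (sym (c-low 1 (s<s z<s)))

  zero-coloured : ℕ → Bool
  zero-coloured i = ⌊ c i Fin.≟ zero ⌋

  nonzero-colours : List (Fin (suc h′))
  nonzero-colours = tabulate suc

  nonzero∈nonzero-colours : ∀ {r} → r ≢ zero → r ∈ nonzero-colours
  nonzero∈nonzero-colours {zero}  r≢0 = ⊥-elim (r≢0 refl)
  nonzero∈nonzero-colours {suc q} _   = ∈-tabulate⁺ q

  module _ (n : ℕ) where

    -- t + n digits suffice since n < g^n, and leave room for a shift by t.
    private
      M : ℕ
      M = t + n

    zero-part : ℕ → ℕ
    zero-part = restrict zero-coloured (digit n)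

    other-part : ℕ → ℕ
    other-part = restrict (not ∘ zero-coloured) (digit n)

    n≡zero-part+other-part : n ≡ eval zero-part M + eval other-part M
    n≡zero-part+other-part =
      trans (sym (eval-digit M n (<-≤-trans (n<g^n 1<g n) (^-monoʳ-≤ g (m≤n+m n t))))) (eval-restrict M zero-coloured (digit n))

    other-part-vanishing : ∀ {i} → c i ≡ zero → other-part i ≡ 0
    other-part-vanishing ci≡0 rewrite ci≡0 = refl

    other-pieces : Σ (List Piece) λ ps → length ps ≤ h′ × total ps ≡ eval other-part M
    other-pieces with colour-pieces M nonzero-colours other-part (restrict-digits _ (digit<g n))
                        (other-part-vanishing (c-low 0 z<s)) (other-part-vanishing (c-low 1 (s<s z<s)))
                        (λ i ≢0 → nonzero∈nonzero-colours
                                    (toWitnessFalse (restrict-support (not ∘ zero-coloured) (digit n) ≢0)))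
    ... | ps , len , total≡ = ps , subst (length ps ≤_) (length-tabulate suc) len , total≡

    module Carry (n≢g : n ≢ g) (zero-part≡g : eval zero-part M ≡ g) where

      shifted : ℕ → ℕ
      shifted i = other-part (t + i)

      y : ℕ
      y = eval shifted n

      shifted-low : ∀ i → i < 2 → shifted i ≡ 0
      shifted-low i i<2 = other-part-vanishing (c-low (t + i) (subst (t + i <_) (+-comm t 2) (+-monoʳ-< t i<2)))

      n≡g+g^t*y : n ≡ g + g ^ t * y
      n≡g+g^t*y = begin
        n                                      ≡⟨ n≡zero-part+other-part ⟩
        eval zero-part M + eval other-part M   ≡⟨ cong₂ _+_ zero-part≡g (eval-shift t n other-part) ⟩
        g + (eval other-part t + g ^ t * y)    ≡⟨ cong (λ x → g + (x + g ^ t * y)) other-part-below-t ⟩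
        g + g ^ t * y                          ∎
        where
        open ≡-Reasoning
        other-part-below-t : eval other-part t ≡ 0
        other-part-below-t = eval-vanishing t other-part λ i i<t → other-part-vanishing (c-low i (≤-trans i<t (m≤n+m t 2)))

      y≢0 : y ≢ 0
      y≢0 y≡0 = n≢g (begin
        n              ≡⟨ n≡g+g^t*y ⟩
        g + g ^ t * y  ≡⟨ cong (λ x → g + g ^ t * x) y≡0 ⟩
        g + g ^ t * 0  ≡⟨ cong (g +_) (*-zeroʳ (g ^ t)) ⟩
        g + 0          ≡⟨ +-identityʳ g ⟩
        g              ∎)
        where open ≡-Reasoning

      1<n : 1 < n
      1<n = <-≤-trans 1<g (subst (g ≤_) (sym n≡g+g^t*y) (m≤m+n g _))

      shifted<g : Digits shifted
      shifted<g i = restrict-digits (not ∘ zero-coloured) (digit<g n) (t + i)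

      shifted-monochrome : Monochrome shifted zero
      shifted-monochrome i ≢0 = c-shift i (toWitnessFalse (restrict-support (not ∘ zero-coloured) (digit n) ≢0))

      Y : Piece
      Y = piece shifted n zero shifted<g shifted-monochrome y≢0 (eval≢g n shifted (shifted-low 0 z<s) (shifted-low 1 (s<s z<s)))

      Y+g-value : eval (λ i → shifted i + single 1 1 i) n ≡ y + g
      Y+g-value = trans (eval-+ n shifted (single 1 1))
                        (cong (y +_) (trans (eval-single 1 1 1<n) (trans (*-identityˡ (g * 1)) (*-identityʳ g))))

      Y+g : Piece
      Y+g = piece (λ i → shifted i + single 1 1 i) n zero
        (+-digits shifted<g (restrict-digits (_≡ᵇ 1) (λ _ → 1<g))
                  (λ i ≢0 → subst (λ j → shifted j ≡ 0) (sym (single-support {1} {1} {i} ≢0)) (shifted-low 1 (s<s z<s))))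
        (+-monochrome shifted-monochrome (single-monochrome (c-low 1 (s<s z<s))))
        (λ eq → <⇒≢ (<-trans z<s 1<g) (sym (m+n≡0⇒n≡0 y (trans (sym Y+g-value) eq))))
        (λ eq → y≢0 (+-cancelʳ-≡ g y 0 (trans (sym Y+g-value) eq)))

      total-replicate : ∀ k p → total (replicate k p) ≡ k * value p
      total-replicate zero    p = refl
      total-replicate (suc k) p = cong (value p +_) (total-replicate k p)

      carry-pieces : List Piece
      carry-pieces = Y+g ∷ replicate (g ^ t ∸ 1) Y

      length-carry-pieces : length carry-pieces ≡ g ^ t
      length-carry-pieces = trans (cong suc (length-replicate (g ^ t ∸ 1))) (m+[n∸m]≡n (m^n>0 g t))

      total-carry-pieces : total carry-pieces ≡ n
      total-carry-pieces = begin
        value Y+g + total (replicate (g ^ t ∸ 1) Y) ≡⟨ cong₂ _+_ Y+g-value (total-replicate (g ^ t ∸ 1) Y) ⟩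
        y + g + (g ^ t ∸ 1) * y                     ≡⟨ rearrange y g (g ^ t ∸ 1) ⟩
        g + (1 + (g ^ t ∸ 1)) * y                   ≡⟨ cong (λ k → g + k * y) (m+[n∸m]≡n (m^n>0 g t)) ⟩
        g + g ^ t * y                               ≡⟨ n≡g+g^t*y ⟨
        n                                           ∎
        where
        open ≡-Reasoning
        rearrange : ∀ y G k → y + G + k * y ≡ G + (1 + k) * y
        rearrange = solve-∀

    decompose : n ≢ g → Σ (List Piece) λ ps → length ps ≤ suc h′ × total ps ≡ n
    decompose n≢g with eval zero-part M ≟ g
    ... | yes ≡g = carry-pieces , subst (_≤ suc h′) (sym length-carry-pieces) g^t≤h , total-carry-pieces
      where open Carry n≢g ≡g
    ... | no ≢g
      with at-most-one-piece M zero zero-part (restrict-digits zero-coloured (digit<g n))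
             (λ i ≢0 → toWitness (restrict-support zero-coloured (digit n) ≢0)) ≢g
         | other-pieces
    ... | ps , len-ps , total-ps | qs , len-qs , total-qs =
      ps ++ qs ,
      subst (_≤ suc h′) (sym (length-++ ps)) (+-mono-≤ len-ps len-qs) ,
      trans (total-++ ps qs) (trans (cong₂ _+_ total-ps total-qs) (sym n≡zero-part+other-part))

  B-basis : AsymptoticBasis B (suc h′)
  B-basis = suc g + suc h′ * g ^ 3 , represent-large
    where
    represent-large : ∀ n → suc g + suc h′ * g ^ 3 ≤ n → Represents B (suc h′) n
    represent-large n N≤n with decompose n (λ n≡g → <⇒≱ (≤-trans (m≤m+n (suc g) _) N≤n) (≤-reflexive n≡g))
    ... | ps , len , total≡ = subst (Represents B (suc h′)) total≡ (pad c0≡c1 ps len large)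
      where
      large : suc h′ * g ^ 3 ≤ total ps
      large = subst (suc h′ * g ^ 3 ≤_) (sym total≡) (≤-trans (m≤n+m _ (suc g)) N≤n)

toℕ-mod : ∀ m n .{{_ : NonZero n}} → toℕ (m mod n) ≡ m % n
toℕ-mod m n = FinP.toℕ-fromℕ< (m%n<n m n)

residue-quotient : ∀ k j P .{{_ : NonZero P}} → j < P → (k * P + j) % P ≡ j × (k * P + j) / P ≡ k
residue-quotient k j P j<P =
  trans (%-congˡ (+-comm (k * P) j)) (trans ([m+kn]%n≡m%n j k P) (m<n⇒m%n≡m j<P)) ,
  (begin
    (k * P + j) / P    ≡⟨ /-congˡ (+-comm (k * P) j) ⟩
    (j + k * P) / P    ≡⟨ +-distrib-/ j (k * P) no-carry ⟩
    j / P + k * P / P  ≡⟨ cong₂ _+_ (m<n⇒m/n≡0 j<P) (m*n/n≡m k P) ⟩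
    k                  ∎)
  where
  open ≡-Reasoning
  no-carry : j % P + k * P % P < P
  no-carry = subst (_< P) (sym (trans (cong (j % P +_) (m*n%n≡0 k P)) (+-identityʳ (j % P)))) (m%n<n j P)

periodic-intervals : ∀ t P lo hi .{{_ : NonZero P}} → lo + t ≤ suc hi → hi < P →
  (e : ℕ → ℕ) → Injective _≡_ _≡_ e → (W : Subset) →
  (∀ n → W n → lo ≤ n % P × n % P ≤ hi × ∃ λ k → e k ≡ n / P) →
  (∀ k j → lo ≤ j → j ≤ hi → W (e k * P + j)) →
  UnionOfInfManyIntervals t W
periodic-intervals t P lo hi lo+t≤1+hi hi<P e e-injective W cover contain =
  (λ k → e k * P + lo) , (λ k → e k * P + hi) , long , injective , covered , contained
  where
  long : ∀ k → e k * P + lo + t ≤ suc (e k * P + hi)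
  long k = begin
    e k * P + lo + t    ≡⟨ +-assoc (e k * P) lo t ⟩
    e k * P + (lo + t)  ≤⟨ +-monoʳ-≤ (e k * P) lo+t≤1+hi ⟩
    e k * P + suc hi    ≡⟨ +-suc (e k * P) hi ⟩
    suc (e k * P + hi)  ∎
    where open ≤-Reasoning
  injective : Injective _≡_ _≡_ (λ k → e k * P + lo , e k * P + hi)
  injective {k} {k′} eq = e-injective (*-cancelʳ-≡ (e k) (e k′) P (+-cancelʳ-≡ lo _ _ (cong proj₁ eq)))
  covered : ∀ n → W n → ∃ λ k → e k * P + lo ≤ n × n ≤ e k * P + hi
  covered n Wn with cover n Wn
  ... | lo≤r , r≤hi , k , ek≡q = k ,
        subst (_≤ n) (cong (λ x → x * P + lo) (sym ek≡q)) (subst (n / P * P + lo ≤_) (sym n≡) (+-monoʳ-≤ _ lo≤r)) ,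
        subst (n ≤_) (cong (λ x → x * P + hi) (sym ek≡q)) (subst (_≤ n / P * P + hi) (sym n≡) (+-monoʳ-≤ _ r≤hi))
    where
    n≡ : n ≡ n / P * P + n % P
    n≡ = trans (m≡m%n+[m/n]*n n P) (+-comm (n % P) _)
  contained : ∀ n k → e k * P + lo ≤ n → n ≤ e k * P + hi → W n
  contained n k lo≤ ≤hi = subst W n≡ (contain k j (+-cancelˡ-≤ (e k * P) lo j (subst (e k * P + lo ≤_) (sym n≡) lo≤))
                                                (+-cancelˡ-≤ (e k * P) j hi (subst (_≤ e k * P + hi) (sym n≡) ≤hi)))
    where
    j : ℕ
    j = n ∸ e k * P
    n≡ : e k * P + j ≡ n
    n≡ = m+[n∸m]≡n (≤-trans (m≤m+n (e k * P) lo) lo≤)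

module Colouring (t : ℕ) (2≤t : 2 ≤ t) (h′ : ℕ) .{{_ : NonZero h′}} where

  period : ℕ
  period = 3 * t

  private
    0<t : 0 < t
    0<t = <-trans z<s 2≤t

  instance
    2t-nonZero : NonZero (2 * t)
    2t-nonZero = >-nonZero (*-monoʳ-< 2 0<t)
    period-nonZero : NonZero period
    period-nonZero = >-nonZero (*-monoʳ-< 3 0<t)

  colour : ℕ → Fin (suc h′)
  colour n with 2 * t ≤? n % period
  ... | no  _ = zero
  ... | yes _ = suc ((n / period) mod h′)

  colour-zero : ∀ {n} → n % period < 2 * t → colour n ≡ zero
  colour-zero {n} r<2t with 2 * t ≤? n % period
  ... | no  _    = refl
  ... | yes 2t≤r = ⊥-elim (<⇒≱ r<2t 2t≤r)

  colour-suc : ∀ {n} → 2 * t ≤ n % period → colour n ≡ suc ((n / period) mod h′)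
  colour-suc {n} 2t≤r with 2 * t ≤? n % period
  ... | no  2t≰r = ⊥-elim (2t≰r 2t≤r)
  ... | yes _    = refl

  colour-zero⁻¹ : ∀ {n} → colour n ≡ zero → n % period < 2 * t
  colour-zero⁻¹ {n} eq with 2 * t ≤? n % period
  ... | no 2t≰r = ≰⇒> 2t≰r
  colour-zero⁻¹ {n} () | yes _

  colour-suc⁻¹ : ∀ {n q} → colour n ≡ suc q → 2 * t ≤ n % period × (n / period) mod h′ ≡ q
  colour-suc⁻¹ {n} eq with 2 * t ≤? n % period
  colour-suc⁻¹ {n} () | no _
  ... | yes 2t≤r = 2t≤r , FinP.suc-injective eq

  2t<period : 2 * t < period
  2t<period = m<n+m (2 * t) 0<t

  colour-low : ∀ i → i < 2 + t → colour i ≡ zero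
  colour-low i i<2+t = colour-zero (subst (_< 2 * t) (sym (m<n⇒m%n≡m (<-trans i<2t 2t<period))) i<2t)
    where
    i<2t : i < 2 * t
    i<2t = <-≤-trans i<2+t (≤-trans (+-monoˡ-≤ t 2≤t) (≤-reflexive (cong (t +_) (sym (+-identityʳ t)))))

  shift-residue : ∀ i → 2 * t ≤ i % period → (t + i) % period < 2 * t
  shift-residue i 2t≤r = begin-strict
    (t + i) % period                              ≡⟨ %-congˡ {o = period} t+i≡ ⟩
    (s + period + i / period * period) % period   ≡⟨ [m+kn]%n≡m%n (s + period) (i / period) period ⟩
    (s + period) % period                         ≡⟨ [m+n]%n≡m%n s period ⟩
    s % period                                    ≤⟨ m%n≤m s period ⟩
    s                                             <⟨ s<t ⟩
    t                                             ≤⟨ m≤m+n t (t + 0) ⟩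
    2 * t                                         ∎
    where
    open ≤-Reasoning
    r : ℕ
    r = i % period
    s : ℕ
    s = r ∸ 2 * t
    r≡2t+s : r ≡ 2 * t + s
    r≡2t+s = sym (m+[n∸m]≡n 2t≤r)
    s<t : s < t
    s<t = +-cancelˡ-< (2 * t) s t (subst₂ _<_ r≡2t+s (+-comm t (2 * t)) (m%n<n i period))
    t+i≡ : t + i ≡ s + period + i / period * period
    t+i≡ = begin-equality
      t + i                                   ≡⟨ cong (t +_) (m≡m%n+[m/n]*n i period) ⟩
      t + (r + i / period * period)           ≡⟨ +-assoc t r _ ⟨
      t + r + i / period * period             ≡⟨ cong (λ x → t + x + i / period * period) r≡2t+s ⟩
      t + (2 * t + s) + i / period * period   ≡⟨ cong (_+ i / period * period) (trans (sym (+-assoc t (2 * t) s)) (+-comm period s)) ⟩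
      s + period + i / period * period        ∎

  colour-shift : ∀ i → colour (t + i) ≢ zero → colour i ≡ zero
  colour-shift i ≢zero = colour-zero (≰⇒> λ 2t≤r → ≢zero (colour-zero (shift-residue i 2t≤r)))

  colour-intervals : ∀ r → UnionOfInfManyIntervals t (Part colour r)
  colour-intervals zero =
    periodic-intervals t period 0 (pred (2 * t))
      (subst (t ≤_) (sym (suc-pred (2 * t))) (m≤m+n t (t + 0))) (≤-<-trans pred[n]≤n 2t<period)
      (λ k → k) (λ eq → eq) (Part colour zero)
      (λ n eq → z≤n , suc[m]≤n⇒m≤pred[n] (colour-zero⁻¹ eq) , n / period , refl)
      contain
    where
    contain : ∀ k j → 0 ≤ j → j ≤ pred (2 * t) → Part colour zero (k * period + j)
    contain k j _ j≤ = colour-zero (subst (_< 2 * t) (sym (proj₁ (residue-quotient k j period j<period))) j<2t)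
      where
      j<2t : j < 2 * t
      j<2t = m≤pred[n]⇒suc[m]≤n j≤
      j<period : j < period
      j<period = <-trans j<2t 2t<period
  colour-intervals (suc q) =
    periodic-intervals t period (2 * t) (pred period)
      (≤-reflexive (trans (+-comm (2 * t) t) (sym (suc-pred period)))) (m≤pred[n]⇒suc[m]≤n ≤-refl)
      block block-injective (Part colour (suc q)) cover contain
    where
    block : ℕ → ℕ
    block k = toℕ q + k * h′
    block-injective : Injective _≡_ _≡_ block
    block-injective {k} {k′} eq = *-cancelʳ-≡ k k′ h′ (+-cancelˡ-≡ (toℕ q) _ _ eq)
    block-mod : ∀ k → block k mod h′ ≡ q
    block-mod k = FinP.toℕ-injective (begin
      toℕ (block k mod h′)      ≡⟨ toℕ-mod (block k) h′ ⟩
      (toℕ q + k * h′) % h′     ≡⟨ [m+kn]%n≡m%n (toℕ q) k h′ ⟩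
      toℕ q % h′                ≡⟨ m<n⇒m%n≡m (FinP.toℕ<n q) ⟩
      toℕ q                     ∎)
      where open ≡-Reasoning
    block-quotient : ∀ m → m mod h′ ≡ q → block (m / h′) ≡ m
    block-quotient m mod≡q =
      trans (cong (_+ m / h′ * h′) (trans (cong toℕ (sym mod≡q)) (toℕ-mod m h′))) (sym (m≡m%n+[m/n]*n m h′))
    cover : ∀ n → Part colour (suc q) n → 2 * t ≤ n % period × n % period ≤ pred period × ∃ λ k → block k ≡ n / period
    cover n eq with colour-suc⁻¹ eq
    ... | 2t≤r , mod≡q = 2t≤r , suc[m]≤n⇒m≤pred[n] (m%n<n n period) , n / period / h′ , block-quotient (n / period) mod≡q
    contain : ∀ k j → 2 * t ≤ j → j ≤ pred period → Part colour (suc q) (block k * period + j)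
    contain k j 2t≤j j≤ with residue-quotient (block k) j period (m≤pred[n]⇒suc[m]≤n j≤)
    ... | r≡j , q≡k =
      trans (colour-suc (subst (2 * t ≤_) (sym r≡j) 2t≤j)) (cong suc (trans (cong (_mod h′) q≡k) (block-mod k)))

¬minimal-without : ∀ {A : Subset} {H} x → A x → AsymptoticBasis (λ y → A y × y ≢ x) H → ¬ MinimalAsymptoticBasis A H
¬minimal-without x x∈A basis (_ , minimal) = minimal _ ((λ _ → proj₁) , x , x∈A , λ (_ , x≢x) → x≢x refl) basis

base∈A : ∀ {g h} (c : ℕ → Fin h) → 1 < g → UnionA g c g
base∈A {g} c 1<g =
  c 1 , (1 , 1) ∷ [] , (λ ()) , [] ∷ [] , (refl , s≤s z≤n , <⇒≤∸1 1<g) ∷ [] ,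
  sym (trans (+-identityʳ (1 * (g * 1))) (trans (*-identityˡ (g * 1)) (*-identityʳ g)))

theorem1 : (g h t : ℕ) → 2 ≤ g → 2 ≤ t → g ^ t ≤ h →
    Σ (ℕ → Fin h) λ c →
      ((r : Fin h) → UnionOfInfManyIntervals t (Part c r)) ×
      ¬ MinimalAsymptoticBasis (UnionA g c) h
theorem1 g zero t 2≤g 2≤t g^t≤h = ⊥-elim (<⇒≱ (1<g^t 2≤g (<-trans z<s 2≤t)) (≤-trans g^t≤h z≤n))
theorem1 g (suc zero) t 2≤g 2≤t g^t≤h = ⊥-elim (<⇒≱ (1<g^t 2≤g (<-trans z<s 2≤t)) g^t≤h)
theorem1 g (suc (suc h″)) t 2≤g 2≤t g^t≤h =
  colour , colour-intervals , ¬minimal-without g (base∈A colour 2≤g) B-basis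
  where
  open Colouring t 2≤t (suc h″)
  open Decomposition g 2≤g (suc h″) t colour colour-low colour-shift g^t≤h
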